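{- Let $\mathcal C$ be a tidy LD category, let $\mathfrak f$ be a set of morphisms whose targets are $\odot$-products, let $u\in\mathfrak Z$ be non-empty, $f\in\mathfrak f$, $\vec A\in\mathcal C^{|u|}$, and let $h$ be a morphism with target $H^f_u(\vec A)$ such that $\kappa^f_u(\vec A)\circ h$ is not $\mathfrak f$-analysable. (i) If $h$ is a component of $\alpha,\alpha^{ -1},\delta^l,\delta^r,\bar\alpha,\bar\alpha^{ -1}$, then $u=\delta^r,\delta^l,\bar\alpha^{ -1},\bar\alpha,\bar\alpha^{ -1},\bar\alpha$, respectively; moreover, in the first four cases the source $s(f)$ is an $\otimes$-product, and in the last two cases $s(f)$ is an $\odot$-product. (ii) Let $h'$ be a morphism. If $h=\mathrm{id}\otimes h'$, then $\mathrm{ter}(u)=\delta^l$ and $\kappa^f_{\mathrm{init}(u)}(\vec A_{\ge2})\circ h'$ is not $\mathfrak f$-analysable; if $h=h'\otimes\mathrm{id}$, then $\mathrm{ter}(u)=\delta^r$ and $\kappa^f_{\mathrm{init}(u)}(\vec A_{\le|u|-1})\circ h'$ is not $\mathfrak f$-analysable; if $h=\mathrm{id}\odot h'$, then $\mathrm{ter}(u)=\bar\alpha$ and $\kappa^f_{\mathrm{init}(u)}(\vec A_{\ge2})\circ h'$ is not $\mathfrak f$-analysable; if $h=h'\odot\mathrm{id}$, then $\mathrm{ter}(u)=\bar\alpha^{ -1}$ and $\kappa^f_{\mathrm{init}(u)}(\vec A_{\le|u|-1})\circ h'$ is not $\mathfrak f$-analysable.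
   Context: $\mathcal C$ is a unitless LD category: bifunctors $\otimes,\odot$ (no units), natural isomorphisms $\alpha_{A,B,C}:A\otimes(B\otimes C)\to(A\otimes B)\otimes C$, $\bar\alpha_{A,B,C}:A\odot(B\odot C)\to(A\odot B)\odot C$, natural transformations $\delta^l_{A,B,C}:A\otimes(B\odot C)\to(A\otimes B)\odot C$, $\delta^r_{A,B,C}:(A\odot B)\otimes C\to A\odot(B\otimes C)$, satisfying (objects denote identities): (P1) $\alpha_{A\otimes B,C,D}\circ\alpha_{A,B,C\otimes D}=(\alpha_{A,B,C}\otimes D)\circ\alpha_{A,B\otimes C,D}\circ(A\otimes\alpha_{B,C,D})$; (P2) $\delta^l_{A\otimes B,C,D}\circ\alpha_{A,B,C\odot D}=(\alpha_{A,B,C}\odot D)\circ\delta^l_{A,B\otimes C,D}\circ(A\otimes\delta^l_{B,C,D})$; (P3) $\delta^l_{A,B,C\otimes D}\circ(A\otimes\delta^r_{B,C,D})=\delta^r_{A\otimes B,C,D}\circ(\delta^l_{A,B,C}\otimes D)\circ\alpha_{A,B\odot C,D}$; (P4) $\bar\alpha_{A\otimes B,C,D}\circ\delta^l_{A,B,C\odot D}=(\delta^l_{A,B,C}\odot D)\circ\delta^l_{A,B\odot C,D}\circ(A\otimes\bar\alpha_{B,C,D})$; (P5) $(A\odot\alpha_{B,C,D})\circ\delta^r_{A,B,C\otimes D}=\delta^r_{A,B\otimes C,D}\circ(\delta^r_{A,B,C}\otimes D)\circ\alpha_{A\odot B,C,D}$; (P6) $(\delta^r_{A,B,C}\odot D)\circ\delta^l_{A\odot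 B,C,D}=\bar\alpha_{A,B\otimes C,D}\circ(A\odot\delta^l_{B,C,D})\circ\delta^r_{A,B,C\odot D}$; (P7) $\delta^r_{A\odot B,C,D}\circ(\bar\alpha_{A,B,C}\otimes D)=\bar\alpha_{A,B,C\otimes D}\circ(A\odot\delta^r_{B,C,D})\circ\delta^r_{A,B\odot C,D}$; (P8) $\bar\alpha_{A\odot B,C,D}\circ\bar\alpha_{A,B,C\odot D}=(\bar\alpha_{A,B,C}\odot D)\circ\bar\alpha_{A,B\odot C,D}\circ(A\odot\bar\alpha_{B,C,D})$. Tidy: $A_1\otimes A_2=B_1\otimes B_2\Rightarrow A_i=B_i$, same for $\odot$, and $A_1\otimes A_2\ne B_1\odot B_2$. $\otimes$-/$\odot$-products: objects $A_1\otimes A_2$ / $A_1\odot A_2$. $\mathfrak Z$ is the free monoid on letters $\bar\alpha,\bar\alpha^{ -1},\delta^l,\delta^r$; non-empty words factor uniquely as $u=m\,\mathrm{init}(u)$, $m=\mathrm{ter}(u)$ a letter. $\vec A_{\ge k}=(A_k,\dots,A_n)$, $\vec A_{\le k}=(A_1,\dots,A_k)$. For $f:H\to L\odot R$ and $u\in\mathfrak Z$, functors $H^f_u,L^f_u,R^f_u:\mathcal C^{|u|}\to\mathcal C$: $H^f_\emptyset=H,L^f_\emptyset=L,R^f_\emptyset=R$; $H^f_{\bar\alpha u}(\vec A)=A_1\odot H^f_u(\vec A_{\ge2})$, $L^f_{\bar\alpha u}(\vec A)=A_1\odot L^f_u(\vec A_{\ge2})$, $R^f_{\bar\alpha u}(\vec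 A)=R^f_u(\vec A_{\ge2})$; $H^f_{\bar\alpha^{ -1}u}(\vec A)=H^f_u(\vec A_{\le|u|})\odot A_{|u|+1}$, $L^f_{\bar\alpha^{ -1}u}(\vec A)=L^f_u(\vec A_{\le|u|})$, $R^f_{\bar\alpha^{ -1}u}(\vec A)=R^f_u(\vec A_{\le|u|})\odot A_{|u|+1}$; $H^f_{\delta^lu}(\vec A)=A_1\otimes H^f_u(\vec A_{\ge2})$, $L^f_{\delta^lu}(\vec A)=A_1\otimes L^f_u(\vec A_{\ge2})$, $R^f_{\delta^lu}(\vec A)=R^f_u(\vec A_{\ge2})$; $H^f_{\delta^ru}(\vec A)=H^f_u(\vec A_{\le|u|})\otimes A_{|u|+1}$, $L^f_{\delta^ru}(\vec A)=L^f_u(\vec A_{\le|u|})$, $R^f_{\delta^ru}(\vec A)=R^f_u(\vec A_{\le|u|})\otimes A_{|u|+1}$. Natural transformations $\kappa^f_u:H^f_u\to L^f_u\odot R^f_u$: $\kappa^f_\emptyset=f$, $\kappa^f_{\bar\alpha u}=\bar\alpha\circ(\mathrm{id}\odot\kappa^f_u)$, $\kappa^f_{\bar\alpha^{ -1}u}=\bar\alpha^{ -1}\circ(\kappa^f_u\odot\mathrm{id})$, $\kappa^f_{\delta^lu}=\delta^l\circ(\mathrm{id}\otimes\kappa^f_u)$, $\kappa^f_{\delta^ru}=\delta^r\circ(\kappa^f_u\otimes\mathrm{id})$ (evident components). A morphism $g$ is $\mathfrak f$-analysable if $g=(g'\odot g'')\circ\kappa^{f'}_v(\vec B)$ for some morphisms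 $g',g''$, $f'\in\mathfrak f$, $v\in\mathfrak Z$, $\vec B\in\mathcal C^{|v|}$. -}

module Defs where

open import Level using (Level; _⊔_) renaming (suc to lsuc)
open import Data.Product using (Σ; ∃; _×_; _,_)
open import Data.List using (List; []; _∷_; length)
open import Data.Vec using (Vec; []; _∷_; init; last)
open import Relation.Binary.Core using (Rel)
open import Relation.Binary.Structures using (IsEquivalence)
open import Relation.Binary.PropositionalEquality using (_≡_; _≢_; subst₂)

record Category (o ℓ e : Level) : Set (lsuc (o ⊔ ℓ ⊔ e)) where
  infixr 9 _∘_
  infix  4 _≈_
  field
    Obj  : Set o
    Hom  : Obj → Obj → Set ℓ
    _≈_  : ∀ {A B} → Rel (Hom A B) e
    ≈-equiv : ∀ {A B} → IsEquivalence (_≈_ {A} {B})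
    id   : ∀ A → Hom A A
    _∘_  : ∀ {A B C} → Hom B C → Hom A B → Hom A C
    assoc : ∀ {A B C D} {f : Hom A B} {g : Hom B C} {h : Hom C D} →
            (h ∘ g) ∘ f ≈ h ∘ (g ∘ f)
    identityˡ : ∀ {A B} {f : Hom A B} → id B ∘ f ≈ f
    identityʳ : ∀ {A B} {f : Hom A B} → f ∘ id A ≈ f
    ∘-resp-≈ : ∀ {A B C} {f f' : Hom B C} {g g' : Hom A B} →
               f ≈ f' → g ≈ g' → f ∘ g ≈ f' ∘ g'

record LDCategory (o ℓ e : Level) : Set (lsuc (o ⊔ ℓ ⊔ e)) where
  infixr 10 _⊗_ _⊙_ _⊗₁_ _⊙₁_
  field
    cat : Category o ℓ e
  open Category cat public
  field
    _⊗_   : Obj → Obj → Obj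
    _⊗₁_  : ∀ {A B C D} → Hom A B → Hom C D → Hom (A ⊗ C) (B ⊗ D)
    ⊗-id  : ∀ {A B} → id A ⊗₁ id B ≈ id (A ⊗ B)
    ⊗-∘   : ∀ {A B C A' B' C'} {f : Hom B C} {g : Hom A B}
              {f' : Hom B' C'} {g' : Hom A' B'} →
            (f ∘ g) ⊗₁ (f' ∘ g') ≈ (f ⊗₁ f') ∘ (g ⊗₁ g')
    ⊗-resp-≈ : ∀ {A B C D} {f f' : Hom A B} {g g' : Hom C D} →
               f ≈ f' → g ≈ g' → f ⊗₁ g ≈ f' ⊗₁ g'
    _⊙_   : Obj → Obj → Obj
    _⊙₁_  : ∀ {A B C D} → Hom A B → Hom C D → Hom (A ⊙ C) (B ⊙ D)
    ⊙-id  : ∀ {A B} → id A ⊙₁ id B ≈ id (A ⊙ B)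
    ⊙-∘   : ∀ {A B C A' B' C'} {f : Hom B C} {g : Hom A B}
              {f' : Hom B' C'} {g' : Hom A' B'} →
            (f ∘ g) ⊙₁ (f' ∘ g') ≈ (f ⊙₁ f') ∘ (g ⊙₁ g')
    ⊙-resp-≈ : ∀ {A B C D} {f f' : Hom A B} {g g' : Hom C D} →
               f ≈ f' → g ≈ g' → f ⊙₁ g ≈ f' ⊙₁ g'
    α    : ∀ A B C → Hom (A ⊗ (B ⊗ C)) ((A ⊗ B) ⊗ C)
    α⁻¹  : ∀ A B C → Hom ((A ⊗ B) ⊗ C) (A ⊗ (B ⊗ C))
    α-isoˡ : ∀ {A B C} → α⁻¹ A B C ∘ α A B C ≈ id (A ⊗ (B ⊗ C))
    α-isoʳ : ∀ {A B C} → α A B C ∘ α⁻¹ A B C ≈ id ((A ⊗ B) ⊗ C)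
    α-natural : ∀ {A B C A' B' C'} (f : Hom A A') (g : Hom B B') (h : Hom C C') →
                α A' B' C' ∘ (f ⊗₁ (g ⊗₁ h)) ≈ ((f ⊗₁ g) ⊗₁ h) ∘ α A B C
    ᾱ    : ∀ A B C → Hom (A ⊙ (B ⊙ C)) ((A ⊙ B) ⊙ C)
    ᾱ⁻¹  : ∀ A B C → Hom ((A ⊙ B) ⊙ C) (A ⊙ (B ⊙ C))
    ᾱ-isoˡ : ∀ {A B C} → ᾱ⁻¹ A B C ∘ ᾱ A B C ≈ id (A ⊙ (B ⊙ C))
    ᾱ-isoʳ : ∀ {A B C} → ᾱ A B C ∘ ᾱ⁻¹ A B C ≈ id ((A ⊙ B) ⊙ C)
    ᾱ-natural : ∀ {A B C A' B' C'} (f : Hom A A') (g : Hom B B') (h : Hom C C') →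
                ᾱ A' B' C' ∘ (f ⊙₁ (g ⊙₁ h)) ≈ ((f ⊙₁ g) ⊙₁ h) ∘ ᾱ A B C
    δˡ   : ∀ A B C → Hom (A ⊗ (B ⊙ C)) ((A ⊗ B) ⊙ C)
    δʳ   : ∀ A B C → Hom ((A ⊙ B) ⊗ C) (A ⊙ (B ⊗ C))
    δˡ-natural : ∀ {A B C A' B' C'} (f : Hom A A') (g : Hom B B') (h : Hom C C') →
                 δˡ A' B' C' ∘ (f ⊗₁ (g ⊙₁ h)) ≈ ((f ⊗₁ g) ⊙₁ h) ∘ δˡ A B C
    δʳ-natural : ∀ {A B C A' B' C'} (f : Hom A A') (g : Hom B B') (h : Hom C C') →
                 δʳ A' B' C' ∘ ((f ⊙₁ g) ⊗₁ h) ≈ (f ⊙₁ (g ⊗₁ h)) ∘ δʳ A B C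
    P1 : ∀ A B C D →
         α (A ⊗ B) C D ∘ α A B (C ⊗ D)
           ≈ (α A B C ⊗₁ id D) ∘ α A (B ⊗ C) D ∘ (id A ⊗₁ α B C D)
    P2 : ∀ A B C D →
         δˡ (A ⊗ B) C D ∘ α A B (C ⊙ D)
           ≈ (α A B C ⊙₁ id D) ∘ δˡ A (B ⊗ C) D ∘ (id A ⊗₁ δˡ B C D)
    P3 : ∀ A B C D →
         δˡ A B (C ⊗ D) ∘ (id A ⊗₁ δʳ B C D)
           ≈ δʳ (A ⊗ B) C D ∘ (δˡ A B C ⊗₁ id D) ∘ α A (B ⊙ C) D
    P4 : ∀ A B C D →
         ᾱ (A ⊗ B) C D ∘ δˡ A B (C ⊙ D)
           ≈ (δˡ A B C ⊙₁ id D) ∘ δˡ A (B ⊙ C) D ∘ (id A ⊗₁ ᾱ B C D)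
    P5 : ∀ A B C D →
         (id A ⊙₁ α B C D) ∘ δʳ A B (C ⊗ D)
           ≈ δʳ A (B ⊗ C) D ∘ (δʳ A B C ⊗₁ id D) ∘ α (A ⊙ B) C D
    P6 : ∀ A B C D →
         (δʳ A B C ⊙₁ id D) ∘ δˡ (A ⊙ B) C D
           ≈ ᾱ A (B ⊗ C) D ∘ (id A ⊙₁ δˡ B C D) ∘ δʳ A B (C ⊙ D)
    P7 : ∀ A B C D →
         δʳ (A ⊙ B) C D ∘ (ᾱ A B C ⊗₁ id D)
           ≈ ᾱ A B (C ⊗ D) ∘ (id A ⊙₁ δʳ B C D) ∘ δʳ A (B ⊙ C) D
    P8 : ∀ A B C D →
         ᾱ (A ⊙ B) C D ∘ ᾱ A B (C ⊙ D)
           ≈ (ᾱ A B C ⊙₁ id D) ∘ ᾱ A (B ⊙ C) D ∘ (id A ⊙₁ ᾱ B C D)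

-- The monoid 𝔷: words in the letters ᾱ, ᾱ⁻¹, δˡ, δʳ.
-- Letters are written ‵ᾱ, ‵ᾱ⁻¹, ‵δˡ, ‵δʳ.
-- A non-empty word u = m ∷ v has ter(u) = m (the first letter) and init(u) = v.

data Letter : Set where
  ‵ᾱ ‵ᾱ⁻¹ ‵δˡ ‵δʳ : Letter

Word : Set
Word = List Letter

module LDDefs {o ℓ e : Level} (𝒞 : LDCategory o ℓ e) where
  open LDCategory 𝒞 public

  Tidy : Set o
  Tidy = (∀ {A₁ A₂ B₁ B₂} → A₁ ⊗ A₂ ≡ B₁ ⊗ B₂ → A₁ ≡ B₁ × A₂ ≡ B₂)
       × (∀ {A₁ A₂ B₁ B₂} → A₁ ⊙ A₂ ≡ B₁ ⊙ B₂ → A₁ ≡ B₁ × A₂ ≡ B₂)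
       × (∀ {A₁ A₂ B₁ B₂} → A₁ ⊗ A₂ ≢ B₁ ⊙ B₂)

  ⊗-Product : Obj → Set o
  ⊗-Product X = Σ Obj λ A₁ → Σ Obj λ A₂ → X ≡ A₁ ⊗ A₂

  ⊙-Product : Obj → Set o
  ⊙-Product X = Σ Obj λ A₁ → Σ Obj λ A₂ → X ≡ A₁ ⊙ A₂

  infix 4 _≋_
  _≋_ : ∀ {X Y X' Y'} → Hom X Y → Hom X' Y' → Set (o ⊔ e)
  _≋_ {X} {Y} {X'} {Y'} g k =
    Σ (X ≡ X') λ p → Σ (Y ≡ Y') λ q → subst₂ Hom p q g ≈ k

  IsComp-α IsComp-α⁻¹ IsComp-δˡ IsComp-δʳ IsComp-ᾱ IsComp-ᾱ⁻¹ :
    ∀ {X Y} → Hom X Y → Set (o ⊔ e)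
  IsComp-α   h = Σ Obj λ A → Σ Obj λ B → Σ Obj λ C → h ≋ α A B C
  IsComp-α⁻¹ h = Σ Obj λ A → Σ Obj λ B → Σ Obj λ C → h ≋ α⁻¹ A B C
  IsComp-δˡ  h = Σ Obj λ A → Σ Obj λ B → Σ Obj λ C → h ≋ δˡ A B C
  IsComp-δʳ  h = Σ Obj λ A → Σ Obj λ B → Σ Obj λ C → h ≋ δʳ A B C
  IsComp-ᾱ   h = Σ Obj λ A → Σ Obj λ B → Σ Obj λ C → h ≋ ᾱ A B C
  IsComp-ᾱ⁻¹ h = Σ Obj λ A → Σ Obj λ B → Σ Obj λ C → h ≋ ᾱ⁻¹ A B C

  module _ {H L R : Obj} (f : Hom H (L ⊙ R)) where
    Hᶠ Lᶠ Rᶠ : (u : Word) → Vec Obj (length u) → Obj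
    Hᶠ []        []       = H
    Hᶠ (‵ᾱ ∷ u)   (A ∷ As) = A ⊙ Hᶠ u As
    Hᶠ (‵ᾱ⁻¹ ∷ u) As       = Hᶠ u (init As) ⊙ last As
    Hᶠ (‵δˡ ∷ u)  (A ∷ As) = A ⊗ Hᶠ u As
    Hᶠ (‵δʳ ∷ u)  As       = Hᶠ u (init As) ⊗ last As

    Lᶠ []        []       = L
    Lᶠ (‵ᾱ ∷ u)   (A ∷ As) = A ⊙ Lᶠ u As
    Lᶠ (‵ᾱ⁻¹ ∷ u) As       = Lᶠ u (init As)
    Lᶠ (‵δˡ ∷ u)  (A ∷ As) = A ⊗ Lᶠ u As
    Lᶠ (‵δʳ ∷ u)  As       = Lᶠ u (init As)

    Rᶠ []        []       = R
    Rᶠ (‵ᾱ ∷ u)   (A ∷ As) = Rᶠ u As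
    Rᶠ (‵ᾱ⁻¹ ∷ u) As       = Rᶠ u (init As) ⊙ last As
    Rᶠ (‵δˡ ∷ u)  (A ∷ As) = Rᶠ u As
    Rᶠ (‵δʳ ∷ u)  As       = Rᶠ u (init As) ⊗ last As

    κ : (u : Word) (As : Vec Obj (length u)) →
        Hom (Hᶠ u As) (Lᶠ u As ⊙ Rᶠ u As)
    κ []        []       = f
    κ (‵ᾱ ∷ u)   (A ∷ As) = ᾱ A (Lᶠ u As) (Rᶠ u As) ∘ (id A ⊙₁ κ u As)
    κ (‵ᾱ⁻¹ ∷ u) As       =
      ᾱ⁻¹ (Lᶠ u (init As)) (Rᶠ u (init As)) (last As) ∘ (κ u (init As) ⊙₁ id (last As))
    κ (‵δˡ ∷ u)  (A ∷ As) = δˡ A (Lᶠ u As) (Rᶠ u As) ∘ (id A ⊗₁ κ u As)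
    κ (‵δʳ ∷ u)  As       =
      δʳ (Lᶠ u (init As)) (Rᶠ u (init As)) (last As) ∘ (κ u (init As) ⊗₁ id (last As))

  MorphismSet : (p : Level) → Set (o ⊔ ℓ ⊔ lsuc p)
  MorphismSet p = ∀ {X Y} → Hom X Y → Set p

  Analysable : ∀ {p} → MorphismSet p → ∀ {X Y} → Hom X Y → Set (o ⊔ ℓ ⊔ e ⊔ p)
  Analysable 𝔣 g =
    Σ Obj λ H' → Σ Obj λ L' → Σ Obj λ R' → Σ (Hom H' (L' ⊙ R')) λ f' → 𝔣 f' ×
    Σ Word λ v → Σ (Vec Obj (length v)) λ B →
    Σ Obj λ P → Σ Obj λ Q →
    Σ (Hom (Lᶠ f' v B) P) λ g' → Σ (Hom (Rᶠ f' v B) Q) λ g'' →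
      g ≋ (g' ⊙₁ g'') ∘ κ f' v B

-- Tidiness lets one read ter(u), and where needed ter(init u), off the target H^f_u(A) of h.
-- In every case excluded by the statement, naturality and one of (P2)–(P8) rewrite
-- κ^f_u(A) ∘ h as (g' ⊙ g'') ∘ κ^f_v(B) for another word v, so it would be analysable.
-- For h = id ⊗ h' and its variants, κ^f_u(A) ∘ h is the one-letter extension of
-- κ^f_{init u} ∘ h', and analysability passes through such extensions because the
-- structure maps are natural.
module Submission where

open import Defs
open import Level using (Level; _⊔_)
open import Data.Nat using (suc)
open import Data.Product using (Σ; _×_; _,_; proj₁; proj₂)
open import Data.List using ([]; _∷_; length)
open import Data.Vec using (Vec; []; _∷_; tail; init; last; _∷ʳ_)
open import Data.Vec.Properties using (init-∷ʳ; last-∷ʳ)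
open import Data.Empty using (⊥-elim)
open import Relation.Nullary using (¬_)
open import Relation.Binary.PropositionalEquality using (_≡_; _≢_; refl; sym; subst)
open import Relation.Binary.Bundles using (Setoid)
import Relation.Binary.Reasoning.Setoid as SetoidReasoning

module LDCategoryProperties {o ℓ e : Level} (𝒞 : LDCategory o ℓ e) where
  open LDCategory 𝒞

  hom-setoid : Obj → Obj → Setoid ℓ e
  hom-setoid A B = record { Carrier = Hom A B ; _≈_ = _≈_ ; isEquivalence = ≈-equiv }

  module _ {A B : Obj} where
    open Setoid (hom-setoid A B) public
      using () renaming (refl to ≈-refl; sym to ≈-sym; trans to ≈-trans)

  module HomReasoning {A B : Obj} = SetoidReasoning (hom-setoid A B)

  infixr 3 _○_
  _○_ : ∀ {A B} {f g h : Hom A B} → f ≈ g → g ≈ h → f ≈ h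
  _○_ = ≈-trans

  infixr 4 _⟩∘⟨_ refl⟩∘⟨_
  infixl 5 _⟩∘⟨refl

  _⟩∘⟨_ : ∀ {A B C} {f f' : Hom B C} {g g' : Hom A B} →
          f ≈ f' → g ≈ g' → f ∘ g ≈ f' ∘ g'
  _⟩∘⟨_ = ∘-resp-≈

  refl⟩∘⟨_ : ∀ {A B C} {f : Hom B C} {g g' : Hom A B} → g ≈ g' → f ∘ g ≈ f ∘ g'
  refl⟩∘⟨ p = ≈-refl ⟩∘⟨ p

  _⟩∘⟨refl : ∀ {A B C} {f f' : Hom B C} {g : Hom A B} → f ≈ f' → f ∘ g ≈ f' ∘ g
  p ⟩∘⟨refl = p ⟩∘⟨ ≈-refl

  sym-assoc : ∀ {A B C D} {f : Hom A B} {g : Hom B C} {h : Hom C D} →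
              h ∘ (g ∘ f) ≈ (h ∘ g) ∘ f
  sym-assoc = ≈-sym assoc

  pullˡ : ∀ {A B C D} {a : Hom C D} {b : Hom B C} {c : Hom B D} {f : Hom A B} →
          a ∘ b ≈ c → a ∘ (b ∘ f) ≈ c ∘ f
  pullˡ ab≈c = sym-assoc ○ ab≈c ⟩∘⟨refl

  cancelˡ : ∀ {A B C} {i : Hom B C} {j : Hom C B} {f : Hom A B} →
            j ∘ i ≈ id B → j ∘ (i ∘ f) ≈ f
  cancelˡ ji≈id = pullˡ ji≈id ○ identityˡ

  cancelʳ : ∀ {A B C} {i : Hom A B} {j : Hom B A} {f : Hom B C} →
            i ∘ j ≈ id B → (f ∘ i) ∘ j ≈ f
  cancelʳ ij≈id = assoc ○ refl⟩∘⟨ ij≈id ○ identityʳ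

  switchˡ : ∀ {A B C} {i : Hom B C} {j : Hom C B} {x : Hom A B} {y : Hom A C} →
            j ∘ i ≈ id B → i ∘ x ≈ y → x ≈ j ∘ y
  switchˡ ji≈id ix≈y = ≈-sym (cancelˡ ji≈id) ○ refl⟩∘⟨ ix≈y

  switchʳ : ∀ {A B C} {i : Hom A B} {j : Hom B A} {x : Hom A C} {y : Hom B C} →
            i ∘ j ≈ id B → x ≈ y ∘ i → x ∘ j ≈ y
  switchʳ ij≈id x≈yi = x≈yi ⟩∘⟨refl ○ cancelʳ ij≈id

  conjugate : ∀ {A B C D} {i : Hom B D} {j : Hom D B} {i' : Hom A C} {j' : Hom C A}
                {x : Hom A B} {y : Hom C D} →
              j ∘ i ≈ id B → i' ∘ j' ≈ id C → i ∘ x ≈ y ∘ i' → x ∘ j' ≈ j ∘ y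
  conjugate ji≈id i'j'≈id ix≈yi' =
    switchʳ i'j'≈id (switchˡ ji≈id ix≈yi' ○ sym-assoc)

  id⊗-∘ : ∀ {A B C D} {f : Hom B C} {g : Hom A B} →
          id D ⊗₁ (f ∘ g) ≈ (id D ⊗₁ f) ∘ (id D ⊗₁ g)
  id⊗-∘ = ⊗-resp-≈ (≈-sym identityˡ) ≈-refl ○ ⊗-∘

  ∘-⊗id : ∀ {A B C D} {f : Hom B C} {g : Hom A B} →
          (f ∘ g) ⊗₁ id D ≈ (f ⊗₁ id D) ∘ (g ⊗₁ id D)
  ∘-⊗id = ⊗-resp-≈ ≈-refl (≈-sym identityˡ) ○ ⊗-∘

  id⊙-∘ : ∀ {A B C D} {f : Hom B C} {g : Hom A B} →
          id D ⊙₁ (f ∘ g) ≈ (id D ⊙₁ f) ∘ (id D ⊙₁ g)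
  id⊙-∘ = ⊙-resp-≈ (≈-sym identityˡ) ≈-refl ○ ⊙-∘

  ∘-⊙id : ∀ {A B C D} {f : Hom B C} {g : Hom A B} →
          (f ∘ g) ⊙₁ id D ≈ (f ⊙₁ id D) ∘ (g ⊙₁ id D)
  ∘-⊙id = ⊙-resp-≈ ≈-refl (≈-sym identityˡ) ○ ⊙-∘

  ⊗-interchange : ∀ {A B C D} {f : Hom A B} {g : Hom C D} →
                  (f ⊗₁ id D) ∘ (id A ⊗₁ g) ≈ (id B ⊗₁ g) ∘ (f ⊗₁ id C)
  ⊗-interchange =
    ≈-sym ⊗-∘ ○ ⊗-resp-≈ (identityʳ ○ ≈-sym identityˡ) (identityˡ ○ ≈-sym identityʳ) ○ ⊗-∘

  ⊙-interchange : ∀ {A B C D} {f : Hom A B} {g : Hom C D} →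
                  (f ⊙₁ id D) ∘ (id A ⊙₁ g) ≈ (id B ⊙₁ g) ∘ (f ⊙₁ id C)
  ⊙-interchange =
    ≈-sym ⊙-∘ ○ ⊙-resp-≈ (identityʳ ○ ≈-sym identityˡ) (identityˡ ○ ≈-sym identityʳ) ○ ⊙-∘

  ⊗-inverse : ∀ {A B C D} {i : Hom A B} {j : Hom B A} {i' : Hom C D} {j' : Hom D C} →
              j ∘ i ≈ id A → j' ∘ i' ≈ id C → (j ⊗₁ j') ∘ (i ⊗₁ i') ≈ id (A ⊗ C)
  ⊗-inverse ji≈id j'i'≈id = ≈-sym ⊗-∘ ○ ⊗-resp-≈ ji≈id j'i'≈id ○ ⊗-id

  ⊙-inverse : ∀ {A B C D} {i : Hom A B} {j : Hom B A} {i' : Hom C D} {j' : Hom D C} →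
              j ∘ i ≈ id A → j' ∘ i' ≈ id C → (j ⊙₁ j') ∘ (i ⊙₁ i') ≈ id (A ⊙ C)
  ⊙-inverse ji≈id j'i'≈id = ≈-sym ⊙-∘ ○ ⊙-resp-≈ ji≈id j'i'≈id ○ ⊙-id

  ∘-inverse : ∀ {A B C} {i : Hom A B} {j : Hom B A} {i' : Hom B C} {j' : Hom C B} →
              j ∘ i ≈ id A → j' ∘ i' ≈ id B → (j ∘ j') ∘ (i' ∘ i) ≈ id A
  ∘-inverse ji≈id j'i'≈id = assoc ○ refl⟩∘⟨ cancelˡ j'i'≈id ○ ji≈id

  ᾱ⁻¹-natural : ∀ {A B C A' B' C'} (f : Hom A A') (g : Hom B B') (h : Hom C C') →
                ᾱ⁻¹ A' B' C' ∘ ((f ⊙₁ g) ⊙₁ h) ≈ (f ⊙₁ (g ⊙₁ h)) ∘ ᾱ⁻¹ A B C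
  ᾱ⁻¹-natural f g h = ≈-sym (conjugate ᾱ-isoˡ ᾱ-isoʳ (ᾱ-natural f g h))

  -- κ f (m ∷ u) is, definitionally, the extension of κ f u along the letter m.
  extδˡ : ∀ x {X L R} → Hom X (L ⊙ R) → Hom (x ⊗ X) ((x ⊗ L) ⊙ R)
  extδˡ x {L = L} {R} k = δˡ x L R ∘ (id x ⊗₁ k)

  extδʳ : ∀ {X L R} → Hom X (L ⊙ R) → ∀ d → Hom (X ⊗ d) (L ⊙ (R ⊗ d))
  extδʳ {L = L} {R} k d = δʳ L R d ∘ (k ⊗₁ id d)

  extᾱ : ∀ x {X L R} → Hom X (L ⊙ R) → Hom (x ⊙ X) ((x ⊙ L) ⊙ R)
  extᾱ x {L = L} {R} k = ᾱ x L R ∘ (id x ⊙₁ k)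

  extᾱ⁻¹ : ∀ {X L R} → Hom X (L ⊙ R) → ∀ d → Hom (X ⊙ d) (L ⊙ (R ⊙ d))
  extᾱ⁻¹ {L = L} {R} k d = ᾱ⁻¹ L R d ∘ (k ⊙₁ id d)

  module _ {X L R : Obj} (k : Hom X (L ⊙ R)) where
    open HomReasoning

    extδˡ-α : ∀ a b → extδˡ (a ⊗ b) k ∘ α a b X ≈ (α a b L ⊙₁ id R) ∘ extδˡ a (extδˡ b k)
    extδˡ-α a b = begin
      (δˡ (a ⊗ b) L R ∘ (id (a ⊗ b) ⊗₁ k)) ∘ α a b X
        ≈⟨ assoc ○ refl⟩∘⟨ (⊗-resp-≈ (≈-sym ⊗-id) ≈-refl ⟩∘⟨refl) ⟩
      δˡ (a ⊗ b) L R ∘ ((id a ⊗₁ id b) ⊗₁ k) ∘ α a b X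
        ≈⟨ refl⟩∘⟨ α-natural (id a) (id b) k ⟨
      δˡ (a ⊗ b) L R ∘ α a b (L ⊙ R) ∘ (id a ⊗₁ id b ⊗₁ k)
        ≈⟨ pullˡ (P2 a b L R) ○ assoc ○ refl⟩∘⟨ assoc ⟩
      (α a b L ⊙₁ id R) ∘ δˡ a (b ⊗ L) R ∘ (id a ⊗₁ δˡ b L R) ∘ (id a ⊗₁ id b ⊗₁ k)
        ≈⟨ refl⟩∘⟨ refl⟩∘⟨ id⊗-∘ ⟨
      (α a b L ⊙₁ id R) ∘ extδˡ a (extδˡ b k) ∎

    extδʳ-extδˡ-α : ∀ a d → extδʳ (extδˡ a k) d ∘ α a X d ≈ extδˡ a (extδʳ k d)
    extδʳ-extδˡ-α a d = begin
      (δʳ (a ⊗ L) R d ∘ ((δˡ a L R ∘ (id a ⊗₁ k)) ⊗₁ id d)) ∘ α a X d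
        ≈⟨ assoc ○ refl⟩∘⟨ (∘-⊗id ⟩∘⟨refl ○ assoc) ⟩
      δʳ (a ⊗ L) R d ∘ (δˡ a L R ⊗₁ id d) ∘ ((id a ⊗₁ k) ⊗₁ id d) ∘ α a X d
        ≈⟨ refl⟩∘⟨ refl⟩∘⟨ α-natural (id a) k (id d) ⟨
      δʳ (a ⊗ L) R d ∘ (δˡ a L R ⊗₁ id d) ∘ α a (L ⊙ R) d ∘ (id a ⊗₁ (k ⊗₁ id d))
        ≈⟨ refl⟩∘⟨ sym-assoc ○ pullˡ (≈-sym (P3 a L R d)) ○ assoc ⟩
      δˡ a L (R ⊗ d) ∘ (id a ⊗₁ δʳ L R d) ∘ (id a ⊗₁ (k ⊗₁ id d))
        ≈⟨ refl⟩∘⟨ id⊗-∘ ⟨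
      extδˡ a (extδʳ k d) ∎

    extδʳ-extδʳ-α : ∀ b c → extδʳ (extδʳ k b) c ∘ α X b c ≈ (id L ⊙₁ α R b c) ∘ extδʳ k (b ⊗ c)
    extδʳ-extδʳ-α b c = begin
      (δʳ L (R ⊗ b) c ∘ ((δʳ L R b ∘ (k ⊗₁ id b)) ⊗₁ id c)) ∘ α X b c
        ≈⟨ assoc ○ refl⟩∘⟨ (∘-⊗id ⟩∘⟨refl ○ assoc) ⟩
      δʳ L (R ⊗ b) c ∘ (δʳ L R b ⊗₁ id c) ∘ ((k ⊗₁ id b) ⊗₁ id c) ∘ α X b c
        ≈⟨ refl⟩∘⟨ refl⟩∘⟨ α-natural k (id b) (id c) ⟨
      δʳ L (R ⊗ b) c ∘ (δʳ L R b ⊗₁ id c) ∘ α (L ⊙ R) b c ∘ (k ⊗₁ (id b ⊗₁ id c))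
        ≈⟨ refl⟩∘⟨ sym-assoc ○ pullˡ (≈-sym (P5 L R b c)) ○ assoc ⟩
      (id L ⊙₁ α R b c) ∘ δʳ L R (b ⊗ c) ∘ (k ⊗₁ (id b ⊗₁ id c))
        ≈⟨ refl⟩∘⟨ refl⟩∘⟨ ⊗-resp-≈ ≈-refl ⊗-id ⟩
      (id L ⊙₁ α R b c) ∘ extδʳ k (b ⊗ c) ∎

    extᾱ-δˡ : ∀ a b → extᾱ (a ⊗ b) k ∘ δˡ a b X ≈ (δˡ a b L ⊙₁ id R) ∘ extδˡ a (extᾱ b k)
    extᾱ-δˡ a b = begin
      (ᾱ (a ⊗ b) L R ∘ (id (a ⊗ b) ⊙₁ k)) ∘ δˡ a b X
        ≈⟨ assoc ○ refl⟩∘⟨ (⊙-resp-≈ (≈-sym ⊗-id) ≈-refl ⟩∘⟨refl) ⟩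
      ᾱ (a ⊗ b) L R ∘ ((id a ⊗₁ id b) ⊙₁ k) ∘ δˡ a b X
        ≈⟨ refl⟩∘⟨ δˡ-natural (id a) (id b) k ⟨
      ᾱ (a ⊗ b) L R ∘ δˡ a b (L ⊙ R) ∘ (id a ⊗₁ (id b ⊙₁ k))
        ≈⟨ pullˡ (P4 a b L R) ○ assoc ○ refl⟩∘⟨ assoc ⟩
      (δˡ a b L ⊙₁ id R) ∘ δˡ a (b ⊙ L) R ∘ (id a ⊗₁ ᾱ b L R) ∘ (id a ⊗₁ (id b ⊙₁ k))
        ≈⟨ refl⟩∘⟨ refl⟩∘⟨ id⊗-∘ ⟨
      (δˡ a b L ⊙₁ id R) ∘ extδˡ a (extᾱ b k) ∎

    extᾱ⁻¹-extδˡ-δˡ : ∀ a d → extᾱ⁻¹ (extδˡ a k) d ∘ δˡ a X d ≈ extδˡ a (extᾱ⁻¹ k d)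
    extᾱ⁻¹-extδˡ-δˡ a d = begin
      (ᾱ⁻¹ (a ⊗ L) R d ∘ ((δˡ a L R ∘ (id a ⊗₁ k)) ⊙₁ id d)) ∘ δˡ a X d
        ≈⟨ assoc ○ refl⟩∘⟨ (∘-⊙id ⟩∘⟨refl ○ assoc) ⟩
      ᾱ⁻¹ (a ⊗ L) R d ∘ (δˡ a L R ⊙₁ id d) ∘ ((id a ⊗₁ k) ⊙₁ id d) ∘ δˡ a X d
        ≈⟨ refl⟩∘⟨ refl⟩∘⟨ δˡ-natural (id a) k (id d) ⟨
      ᾱ⁻¹ (a ⊗ L) R d ∘ (δˡ a L R ⊙₁ id d) ∘ δˡ a (L ⊙ R) d ∘ (id a ⊗₁ (k ⊙₁ id d))
        ≈⟨ refl⟩∘⟨ sym-assoc ○ pullˡ P4′ ○ assoc ⟩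
      δˡ a L (R ⊙ d) ∘ (id a ⊗₁ ᾱ⁻¹ L R d) ∘ (id a ⊗₁ (k ⊙₁ id d))
        ≈⟨ refl⟩∘⟨ id⊗-∘ ⟨
      extδˡ a (extᾱ⁻¹ k d) ∎
      where
      P4′ : ᾱ⁻¹ (a ⊗ L) R d ∘ (δˡ a L R ⊙₁ id d) ∘ δˡ a (L ⊙ R) d
          ≈ δˡ a L (R ⊙ d) ∘ (id a ⊗₁ ᾱ⁻¹ L R d)
      P4′ = ≈-sym (conjugate ᾱ-isoˡ (⊗-inverse identityˡ ᾱ-isoʳ) (P4 a L R d ○ sym-assoc))

    extᾱ⁻¹-extδʳ-δˡ : ∀ b c →
                      extᾱ⁻¹ (extδʳ k b) c ∘ δˡ X b c ≈ (id L ⊙₁ δˡ R b c) ∘ extδʳ k (b ⊙ c)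
    extᾱ⁻¹-extδʳ-δˡ b c = begin
      (ᾱ⁻¹ L (R ⊗ b) c ∘ ((δʳ L R b ∘ (k ⊗₁ id b)) ⊙₁ id c)) ∘ δˡ X b c
        ≈⟨ assoc ○ refl⟩∘⟨ (∘-⊙id ⟩∘⟨refl ○ assoc) ⟩
      ᾱ⁻¹ L (R ⊗ b) c ∘ (δʳ L R b ⊙₁ id c) ∘ ((k ⊗₁ id b) ⊙₁ id c) ∘ δˡ X b c
        ≈⟨ refl⟩∘⟨ refl⟩∘⟨ δˡ-natural k (id b) (id c) ⟨
      ᾱ⁻¹ L (R ⊗ b) c ∘ (δʳ L R b ⊙₁ id c) ∘ δˡ (L ⊙ R) b c ∘ (k ⊗₁ (id b ⊙₁ id c))
        ≈⟨ refl⟩∘⟨ (pullˡ (P6 L R b c) ○ assoc) ○ cancelˡ ᾱ-isoˡ ⟩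
      ((id L ⊙₁ δˡ R b c) ∘ δʳ L R (b ⊙ c)) ∘ (k ⊗₁ (id b ⊙₁ id c))
        ≈⟨ assoc ○ refl⟩∘⟨ refl⟩∘⟨ ⊗-resp-≈ ≈-refl ⊙-id ⟩
      (id L ⊙₁ δˡ R b c) ∘ extδʳ k (b ⊙ c) ∎

    extᾱ⁻¹-δʳ : ∀ b c → extᾱ⁻¹ k (b ⊗ c) ∘ δʳ X b c ≈ (id L ⊙₁ δʳ R b c) ∘ extδʳ (extᾱ⁻¹ k b) c
    extᾱ⁻¹-δʳ b c = begin
      (ᾱ⁻¹ L R (b ⊗ c) ∘ (k ⊙₁ id (b ⊗ c))) ∘ δʳ X b c
        ≈⟨ assoc ○ refl⟩∘⟨ (⊙-resp-≈ ≈-refl (≈-sym ⊗-id) ⟩∘⟨refl) ⟩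
      ᾱ⁻¹ L R (b ⊗ c) ∘ (k ⊙₁ (id b ⊗₁ id c)) ∘ δʳ X b c
        ≈⟨ refl⟩∘⟨ δʳ-natural k (id b) (id c) ⟨
      ᾱ⁻¹ L R (b ⊗ c) ∘ δʳ (L ⊙ R) b c ∘ ((k ⊙₁ id b) ⊗₁ id c)
        ≈⟨ pullˡ P7′ ○ assoc ○ assoc ⟩
      (id L ⊙₁ δʳ R b c) ∘ δʳ L (R ⊙ b) c ∘ (ᾱ⁻¹ L R b ⊗₁ id c) ∘ ((k ⊙₁ id b) ⊗₁ id c)
        ≈⟨ refl⟩∘⟨ refl⟩∘⟨ ∘-⊗id ⟨
      (id L ⊙₁ δʳ R b c) ∘ extδʳ (extᾱ⁻¹ k b) c ∎
      where
      P7′ : ᾱ⁻¹ L R (b ⊗ c) ∘ δʳ (L ⊙ R) b c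
          ≈ ((id L ⊙₁ δʳ R b c) ∘ δʳ L (R ⊙ b) c) ∘ (ᾱ⁻¹ L R b ⊗₁ id c)
      P7′ = ≈-sym (conjugate ᾱ-isoˡ (⊗-inverse ᾱ-isoʳ identityˡ) (≈-sym (P7 L R b c)))

    extᾱ-extδˡ-δʳ : ∀ a b → extᾱ a (extδˡ b k) ∘ δʳ a b X ≈ (δʳ a b L ⊙₁ id R) ∘ extδˡ (a ⊙ b) k
    extᾱ-extδˡ-δʳ a b = begin
      (ᾱ a (b ⊗ L) R ∘ (id a ⊙₁ (δˡ b L R ∘ (id b ⊗₁ k)))) ∘ δʳ a b X
        ≈⟨ assoc ○ refl⟩∘⟨ (id⊙-∘ ⟩∘⟨refl ○ assoc) ⟩
      ᾱ a (b ⊗ L) R ∘ (id a ⊙₁ δˡ b L R) ∘ (id a ⊙₁ (id b ⊗₁ k)) ∘ δʳ a b X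
        ≈⟨ refl⟩∘⟨ refl⟩∘⟨ δʳ-natural (id a) (id b) k ⟨
      ᾱ a (b ⊗ L) R ∘ (id a ⊙₁ δˡ b L R) ∘ δʳ a b (L ⊙ R) ∘ ((id a ⊙₁ id b) ⊗₁ k)
        ≈⟨ refl⟩∘⟨ sym-assoc ○ pullˡ (≈-sym (P6 a b L R)) ○ assoc ⟩
      (δʳ a b L ⊙₁ id R) ∘ δˡ (a ⊙ b) L R ∘ ((id a ⊙₁ id b) ⊗₁ k)
        ≈⟨ refl⟩∘⟨ refl⟩∘⟨ ⊗-resp-≈ ⊙-id ≈-refl ⟩
      (δʳ a b L ⊙₁ id R) ∘ extδˡ (a ⊙ b) k ∎

    extᾱ-extδʳ-δʳ : ∀ a d → extᾱ a (extδʳ k d) ∘ δʳ a X d ≈ extδʳ (extᾱ a k) d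
    extᾱ-extδʳ-δʳ a d = begin
      (ᾱ a L (R ⊗ d) ∘ (id a ⊙₁ (δʳ L R d ∘ (k ⊗₁ id d)))) ∘ δʳ a X d
        ≈⟨ assoc ○ refl⟩∘⟨ (id⊙-∘ ⟩∘⟨refl ○ assoc) ⟩
      ᾱ a L (R ⊗ d) ∘ (id a ⊙₁ δʳ L R d) ∘ (id a ⊙₁ (k ⊗₁ id d)) ∘ δʳ a X d
        ≈⟨ refl⟩∘⟨ refl⟩∘⟨ δʳ-natural (id a) k (id d) ⟨
      ᾱ a L (R ⊗ d) ∘ (id a ⊙₁ δʳ L R d) ∘ δʳ a (L ⊙ R) d ∘ ((id a ⊙₁ k) ⊗₁ id d)
        ≈⟨ refl⟩∘⟨ sym-assoc ○ pullˡ (≈-sym (P7 a L R d)) ○ assoc ⟩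
      δʳ (a ⊙ L) R d ∘ (ᾱ a L R ⊗₁ id d) ∘ ((id a ⊙₁ k) ⊗₁ id d)
        ≈⟨ refl⟩∘⟨ ∘-⊗id ⟨
      extδʳ (extᾱ a k) d ∎

    extᾱ-ᾱ : ∀ a b → extᾱ (a ⊙ b) k ∘ ᾱ a b X ≈ (ᾱ a b L ⊙₁ id R) ∘ extᾱ a (extᾱ b k)
    extᾱ-ᾱ a b = begin
      (ᾱ (a ⊙ b) L R ∘ (id (a ⊙ b) ⊙₁ k)) ∘ ᾱ a b X
        ≈⟨ assoc ○ refl⟩∘⟨ (⊙-resp-≈ (≈-sym ⊙-id) ≈-refl ⟩∘⟨refl) ⟩
      ᾱ (a ⊙ b) L R ∘ ((id a ⊙₁ id b) ⊙₁ k) ∘ ᾱ a b X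
        ≈⟨ refl⟩∘⟨ ᾱ-natural (id a) (id b) k ⟨
      ᾱ (a ⊙ b) L R ∘ ᾱ a b (L ⊙ R) ∘ (id a ⊙₁ (id b ⊙₁ k))
        ≈⟨ pullˡ (P8 a b L R) ○ assoc ○ refl⟩∘⟨ assoc ⟩
      (ᾱ a b L ⊙₁ id R) ∘ ᾱ a (b ⊙ L) R ∘ (id a ⊙₁ ᾱ b L R) ∘ (id a ⊙₁ (id b ⊙₁ k))
        ≈⟨ refl⟩∘⟨ refl⟩∘⟨ id⊙-∘ ⟨
      (ᾱ a b L ⊙₁ id R) ∘ extᾱ a (extᾱ b k) ∎

    extᾱ⁻¹-extᾱ-ᾱ : ∀ a d → extᾱ⁻¹ (extᾱ a k) d ∘ ᾱ a X d ≈ extᾱ a (extᾱ⁻¹ k d)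
    extᾱ⁻¹-extᾱ-ᾱ a d = begin
      (ᾱ⁻¹ (a ⊙ L) R d ∘ ((ᾱ a L R ∘ (id a ⊙₁ k)) ⊙₁ id d)) ∘ ᾱ a X d
        ≈⟨ assoc ○ refl⟩∘⟨ (∘-⊙id ⟩∘⟨refl ○ assoc) ⟩
      ᾱ⁻¹ (a ⊙ L) R d ∘ (ᾱ a L R ⊙₁ id d) ∘ ((id a ⊙₁ k) ⊙₁ id d) ∘ ᾱ a X d
        ≈⟨ refl⟩∘⟨ refl⟩∘⟨ ᾱ-natural (id a) k (id d) ⟨
      ᾱ⁻¹ (a ⊙ L) R d ∘ (ᾱ a L R ⊙₁ id d) ∘ ᾱ a (L ⊙ R) d ∘ (id a ⊙₁ (k ⊙₁ id d))
        ≈⟨ refl⟩∘⟨ sym-assoc ○ pullˡ P8′ ○ assoc ⟩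
      ᾱ a L (R ⊙ d) ∘ (id a ⊙₁ ᾱ⁻¹ L R d) ∘ (id a ⊙₁ (k ⊙₁ id d))
        ≈⟨ refl⟩∘⟨ id⊙-∘ ⟨
      extᾱ a (extᾱ⁻¹ k d) ∎
      where
      P8′ : ᾱ⁻¹ (a ⊙ L) R d ∘ (ᾱ a L R ⊙₁ id d) ∘ ᾱ a (L ⊙ R) d
          ≈ ᾱ a L (R ⊙ d) ∘ (id a ⊙₁ ᾱ⁻¹ L R d)
      P8′ = ≈-sym (conjugate ᾱ-isoˡ (⊙-inverse identityˡ ᾱ-isoʳ) (P8 a L R d ○ sym-assoc))

    extᾱ⁻¹-extᾱ⁻¹-ᾱ : ∀ b c →
                      extᾱ⁻¹ (extᾱ⁻¹ k b) c ∘ ᾱ X b c ≈ (id L ⊙₁ ᾱ R b c) ∘ extᾱ⁻¹ k (b ⊙ c)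
    extᾱ⁻¹-extᾱ⁻¹-ᾱ b c = begin
      (ᾱ⁻¹ L (R ⊙ b) c ∘ ((ᾱ⁻¹ L R b ∘ (k ⊙₁ id b)) ⊙₁ id c)) ∘ ᾱ X b c
        ≈⟨ assoc ○ refl⟩∘⟨ (∘-⊙id ⟩∘⟨refl ○ assoc) ⟩
      ᾱ⁻¹ L (R ⊙ b) c ∘ (ᾱ⁻¹ L R b ⊙₁ id c) ∘ ((k ⊙₁ id b) ⊙₁ id c) ∘ ᾱ X b c
        ≈⟨ refl⟩∘⟨ refl⟩∘⟨ ᾱ-natural k (id b) (id c) ⟨
      ᾱ⁻¹ L (R ⊙ b) c ∘ (ᾱ⁻¹ L R b ⊙₁ id c) ∘ ᾱ (L ⊙ R) b c ∘ (k ⊙₁ (id b ⊙₁ id c))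
        ≈⟨ refl⟩∘⟨ sym-assoc ○ pullˡ P8′ ○ assoc ⟩
      (id L ⊙₁ ᾱ R b c) ∘ ᾱ⁻¹ L R (b ⊙ c) ∘ (k ⊙₁ (id b ⊙₁ id c))
        ≈⟨ refl⟩∘⟨ refl⟩∘⟨ ⊙-resp-≈ ≈-refl ⊙-id ⟩
      (id L ⊙₁ ᾱ R b c) ∘ extᾱ⁻¹ k (b ⊙ c) ∎
      where
      P8′ : ᾱ⁻¹ L (R ⊙ b) c ∘ (ᾱ⁻¹ L R b ⊙₁ id c) ∘ ᾱ (L ⊙ R) b c
          ≈ (id L ⊙₁ ᾱ R b c) ∘ ᾱ⁻¹ L R (b ⊙ c)
      P8′ = ≈-sym (conjugate (∘-inverse ᾱ-isoˡ (⊙-inverse ᾱ-isoˡ identityˡ)) ᾱ-isoʳ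
                             (≈-sym (P8 L R b c ○ sym-assoc)) ○ assoc)

    extδʳ-α⁻¹ : ∀ b c → extδʳ k (b ⊗ c) ∘ α⁻¹ X b c ≈ (id L ⊙₁ α⁻¹ R b c) ∘ extδʳ (extδʳ k b) c
    extδʳ-α⁻¹ b c = conjugate (⊙-inverse identityˡ α-isoˡ) α-isoʳ (≈-sym (extδʳ-extδʳ-α b c))

    extδˡ-extδˡ-α⁻¹ : ∀ a b →
                      extδˡ a (extδˡ b k) ∘ α⁻¹ a b X ≈ (α⁻¹ a b L ⊙₁ id R) ∘ extδˡ (a ⊗ b) k
    extδˡ-extδˡ-α⁻¹ a b = conjugate (⊙-inverse α-isoˡ identityˡ) α-isoʳ (≈-sym (extδˡ-α a b))

    extδˡ-extδʳ-α⁻¹ : ∀ a d → extδˡ a (extδʳ k d) ∘ α⁻¹ a X d ≈ extδʳ (extδˡ a k) d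
    extδˡ-extδʳ-α⁻¹ a d = switchʳ α-isoʳ (≈-sym (extδʳ-extδˡ-α a d))

    extᾱ⁻¹-ᾱ⁻¹ : ∀ b c →
                 extᾱ⁻¹ k (b ⊙ c) ∘ ᾱ⁻¹ X b c ≈ (id L ⊙₁ ᾱ⁻¹ R b c) ∘ extᾱ⁻¹ (extᾱ⁻¹ k b) c
    extᾱ⁻¹-ᾱ⁻¹ b c = conjugate (⊙-inverse identityˡ ᾱ-isoˡ) ᾱ-isoʳ (≈-sym (extᾱ⁻¹-extᾱ⁻¹-ᾱ b c))

    extᾱ-extᾱ-ᾱ⁻¹ : ∀ a b → extᾱ a (extᾱ b k) ∘ ᾱ⁻¹ a b X ≈ (ᾱ⁻¹ a b L ⊙₁ id R) ∘ extᾱ (a ⊙ b) k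
    extᾱ-extᾱ-ᾱ⁻¹ a b = conjugate (⊙-inverse ᾱ-isoˡ identityˡ) ᾱ-isoʳ (≈-sym (extᾱ-ᾱ a b))

    extᾱ-extᾱ⁻¹-ᾱ⁻¹ : ∀ a d → extᾱ a (extᾱ⁻¹ k d) ∘ ᾱ⁻¹ a X d ≈ extᾱ⁻¹ (extᾱ a k) d
    extᾱ-extᾱ⁻¹-ᾱ⁻¹ a d = switchʳ ᾱ-isoʳ (≈-sym (extᾱ⁻¹-extᾱ-ᾱ a d))

    extδˡ-∘ : ∀ x {W} (h : Hom W X) → extδˡ x k ∘ (id x ⊗₁ h) ≈ extδˡ x (k ∘ h)
    extδˡ-∘ x h = assoc ○ refl⟩∘⟨ ≈-sym id⊗-∘

    extδʳ-∘ : ∀ d {W} (h : Hom W X) → extδʳ k d ∘ (h ⊗₁ id d) ≈ extδʳ (k ∘ h) d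
    extδʳ-∘ d h = assoc ○ refl⟩∘⟨ ≈-sym ∘-⊗id

    extᾱ-∘ : ∀ x {W} (h : Hom W X) → extᾱ x k ∘ (id x ⊙₁ h) ≈ extᾱ x (k ∘ h)
    extᾱ-∘ x h = assoc ○ refl⟩∘⟨ ≈-sym id⊙-∘

    extᾱ⁻¹-∘ : ∀ d {W} (h : Hom W X) → extᾱ⁻¹ k d ∘ (h ⊙₁ id d) ≈ extᾱ⁻¹ (k ∘ h) d
    extᾱ⁻¹-∘ d h = assoc ○ refl⟩∘⟨ ≈-sym ∘-⊙id

    extδˡ-⊗id : ∀ {x x'} (h : Hom x' x) →
                extδˡ x k ∘ (h ⊗₁ id X) ≈ ((h ⊗₁ id L) ⊙₁ id R) ∘ extδˡ x' k
    extδˡ-⊗id h =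
      assoc ○ refl⟩∘⟨ ≈-sym ⊗-interchange ○ refl⟩∘⟨ (⊗-resp-≈ ≈-refl (≈-sym ⊙-id) ⟩∘⟨refl)
      ○ pullˡ (δˡ-natural h (id L) (id R)) ○ assoc

    extδʳ-id⊗ : ∀ {d d'} (h : Hom d' d) →
                extδʳ k d ∘ (id X ⊗₁ h) ≈ (id L ⊙₁ (id R ⊗₁ h)) ∘ extδʳ k d'
    extδʳ-id⊗ h =
      assoc ○ refl⟩∘⟨ ⊗-interchange ○ refl⟩∘⟨ (⊗-resp-≈ (≈-sym ⊙-id) ≈-refl ⟩∘⟨refl)
      ○ pullˡ (δʳ-natural (id L) (id R) h) ○ assoc

    extᾱ-⊙id : ∀ {x x'} (h : Hom x' x) →
               extᾱ x k ∘ (h ⊙₁ id X) ≈ ((h ⊙₁ id L) ⊙₁ id R) ∘ extᾱ x' k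
    extᾱ-⊙id h =
      assoc ○ refl⟩∘⟨ ≈-sym ⊙-interchange ○ refl⟩∘⟨ (⊙-resp-≈ ≈-refl (≈-sym ⊙-id) ⟩∘⟨refl)
      ○ pullˡ (ᾱ-natural h (id L) (id R)) ○ assoc

    extᾱ⁻¹-id⊙ : ∀ {d d'} (h : Hom d' d) →
                 extᾱ⁻¹ k d ∘ (id X ⊙₁ h) ≈ (id L ⊙₁ (id R ⊙₁ h)) ∘ extᾱ⁻¹ k d'
    extᾱ⁻¹-id⊙ h =
      assoc ○ refl⟩∘⟨ ⊙-interchange ○ refl⟩∘⟨ (⊙-resp-≈ (≈-sym ⊙-id) ≈-refl ⟩∘⟨refl)
      ○ pullˡ (ᾱ⁻¹-natural (id L) (id R) h) ○ assoc

  module _ {X L R L' R'} {k : Hom X (L ⊙ R)} {k' : Hom X (L' ⊙ R')}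
           {g : Hom L' L} {g'' : Hom R' R} (k≈ : k ≈ (g ⊙₁ g'') ∘ k') where

    extδˡ-factor : ∀ x → extδˡ x k ≈ ((id x ⊗₁ g) ⊙₁ g'') ∘ extδˡ x k'
    extδˡ-factor x =
      refl⟩∘⟨ (⊗-resp-≈ ≈-refl k≈ ○ id⊗-∘) ○ pullˡ (δˡ-natural (id x) g g'') ○ assoc

    extδʳ-factor : ∀ d → extδʳ k d ≈ (g ⊙₁ (g'' ⊗₁ id d)) ∘ extδʳ k' d
    extδʳ-factor d =
      refl⟩∘⟨ (⊗-resp-≈ k≈ ≈-refl ○ ∘-⊗id) ○ pullˡ (δʳ-natural g g'' (id d)) ○ assoc

    extᾱ-factor : ∀ x → extᾱ x k ≈ ((id x ⊙₁ g) ⊙₁ g'') ∘ extᾱ x k'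
    extᾱ-factor x =
      refl⟩∘⟨ (⊙-resp-≈ ≈-refl k≈ ○ id⊙-∘) ○ pullˡ (ᾱ-natural (id x) g g'') ○ assoc

    extᾱ⁻¹-factor : ∀ d → extᾱ⁻¹ k d ≈ (g ⊙₁ (g'' ⊙₁ id d)) ∘ extᾱ⁻¹ k' d
    extᾱ⁻¹-factor d =
      refl⟩∘⟨ (⊙-resp-≈ k≈ ≈-refl ○ ∘-⊙id) ○ pullˡ (ᾱ⁻¹-natural g g'' (id d)) ○ assoc

module Analysability {o ℓ e p : Level} (𝒞 : LDCategory o ℓ e) (tidy : LDDefs.Tidy 𝒞)
                     (𝔣 : LDDefs.MorphismSet 𝒞 p) where
  open LDDefs 𝒞
  open LDCategoryProperties 𝒞

  ⊗-injective : ∀ {A₁ A₂ B₁ B₂} → A₁ ⊗ A₂ ≡ B₁ ⊗ B₂ → A₁ ≡ B₁ × A₂ ≡ B₂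
  ⊗-injective = proj₁ tidy

  ⊙-injective : ∀ {A₁ A₂ B₁ B₂} → A₁ ⊙ A₂ ≡ B₁ ⊙ B₂ → A₁ ≡ B₁ × A₂ ≡ B₂
  ⊙-injective = proj₁ (proj₂ tidy)

  ⊗≢⊙ : ∀ {A₁ A₂ B₁ B₂} → A₁ ⊗ A₂ ≢ B₁ ⊙ B₂
  ⊗≢⊙ = proj₂ (proj₂ tidy)

  ≋-target : ∀ {X Y X' Y'} {g : Hom X Y} {k : Hom X' Y'} → g ≋ k → Y ≡ Y'
  ≋-target (_ , Y≡Y' , _) = Y≡Y'

  analysed : ∀ {H L R} {f : Hom H (L ⊙ R)} → 𝔣 f → ∀ w B {P Q}
             (g' : Hom (Lᶠ f w B) P) (g'' : Hom (Rᶠ f w B) Q) {k} →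
             k ≈ (g' ⊙₁ g'') ∘ κ f w B → Analysable 𝔣 k
  analysed f∈𝔣 w B g' g'' k≈ = _ , _ , _ , _ , f∈𝔣 , w , B , _ , _ , g' , g'' , refl , refl , k≈

  analysable-≈ : ∀ {X Y} {k k' : Hom X Y} → k ≈ k' → Analysable 𝔣 k → Analysable 𝔣 k'
  analysable-≈ k≈k' (_ , _ , _ , _ , f∈𝔣 , w , B , _ , _ , g' , g'' , refl , refl , k≈) =
    analysed f∈𝔣 w B g' g'' (≈-sym k≈k' ○ k≈)

  analysable-elim : ∀ {q L R} (P : ∀ {X} → Hom X (L ⊙ R) → Set q) →
    (∀ {H L' R'} {f : Hom H (L' ⊙ R')} → 𝔣 f →
       ∀ w B (g' : Hom (Lᶠ f w B) L) (g'' : Hom (Rᶠ f w B) R) {k} →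
       k ≈ (g' ⊙₁ g'') ∘ κ f w B → P k) →
    ∀ {X} {k : Hom X (L ⊙ R)} → Analysable 𝔣 k → P k
  analysable-elim P base (_ , _ , _ , _ , f∈𝔣 , w , B , _ , _ , g' , g'' , refl , q , k≈)
    with refl , refl ← ⊙-injective q | refl ← q = base f∈𝔣 w B g' g'' k≈

  analysable-κ : ∀ {H L R} {f : Hom H (L ⊙ R)} → 𝔣 f → ∀ w B → Analysable 𝔣 (κ f w B)
  analysable-κ f∈𝔣 w B = analysed f∈𝔣 w B (id _) (id _) (≈-sym (⊙-id ⟩∘⟨refl ○ identityˡ))

  analysable-post : ∀ {X L R P Q} (g : Hom L P) (g'' : Hom R Q) {k : Hom X (L ⊙ R)} →
                    Analysable 𝔣 k → Analysable 𝔣 ((g ⊙₁ g'') ∘ k)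
  analysable-post g g'' = analysable-elim (λ k → Analysable 𝔣 ((g ⊙₁ g'') ∘ k))
    λ f∈𝔣 w B g' g''' k≈ →
      analysed f∈𝔣 w B (g ∘ g') (g'' ∘ g''') (refl⟩∘⟨ k≈ ○ sym-assoc ○ ≈-sym ⊙-∘ ⟩∘⟨refl)

  analysable-∘-≋ : ∀ {S S' T Y} {E : Hom T Y} {h : Hom S T} {c : Hom S' T} {k : Hom S' Y} →
                   h ≋ c → E ∘ c ≈ k → Analysable 𝔣 k → Analysable 𝔣 (E ∘ h)
  analysable-∘-≋ (refl , refl , h≈c) E∘c≈k = analysable-≈ (≈-sym (refl⟩∘⟨ h≈c ○ E∘c≈k))

  -- init (B ∷ʳ d) is B only propositionally, hence the generalisation in `at`.
  module _ {H L R} {f : Hom H (L ⊙ R)} (f∈𝔣 : 𝔣 f) (w : Word) where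

    analysable-extδʳ-κ : ∀ B d → Analysable 𝔣 (extδʳ (κ f w B) d)
    analysable-extδʳ-κ B d = at (B ∷ʳ d) (init-∷ʳ d B) (last-∷ʳ d B)
      where
      at : ∀ {B d} B' → init B' ≡ B → last B' ≡ d → Analysable 𝔣 (extδʳ (κ f w B) d)
      at B' refl refl = analysable-κ f∈𝔣 (‵δʳ ∷ w) B'

    analysable-extᾱ⁻¹-κ : ∀ B d → Analysable 𝔣 (extᾱ⁻¹ (κ f w B) d)
    analysable-extᾱ⁻¹-κ B d = at (B ∷ʳ d) (init-∷ʳ d B) (last-∷ʳ d B)
      where
      at : ∀ {B d} B' → init B' ≡ B → last B' ≡ d → Analysable 𝔣 (extᾱ⁻¹ (κ f w B) d)
      at B' refl refl = analysable-κ f∈𝔣 (‵ᾱ⁻¹ ∷ w) B'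

  module _ {X L R} {k : Hom X (L ⊙ R)} where

    analysable-extδˡ : ∀ x → Analysable 𝔣 k → Analysable 𝔣 (extδˡ x k)
    analysable-extδˡ x = analysable-elim (λ k → Analysable 𝔣 (extδˡ x k)) λ f∈𝔣 w B _ _ k≈ →
      analysable-≈ (≈-sym (extδˡ-factor k≈ x))
        (analysable-post _ _ (analysable-κ f∈𝔣 (‵δˡ ∷ w) (x ∷ B)))

    analysable-extδʳ : ∀ d → Analysable 𝔣 k → Analysable 𝔣 (extδʳ k d)
    analysable-extδʳ d = analysable-elim (λ k → Analysable 𝔣 (extδʳ k d)) λ f∈𝔣 w B _ _ k≈ →
      analysable-≈ (≈-sym (extδʳ-factor k≈ d))
        (analysable-post _ _ (analysable-extδʳ-κ f∈𝔣 w B d))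

    analysable-extᾱ : ∀ x → Analysable 𝔣 k → Analysable 𝔣 (extᾱ x k)
    analysable-extᾱ x = analysable-elim (λ k → Analysable 𝔣 (extᾱ x k)) λ f∈𝔣 w B _ _ k≈ →
      analysable-≈ (≈-sym (extᾱ-factor k≈ x))
        (analysable-post _ _ (analysable-κ f∈𝔣 (‵ᾱ ∷ w) (x ∷ B)))

    analysable-extᾱ⁻¹ : ∀ d → Analysable 𝔣 k → Analysable 𝔣 (extᾱ⁻¹ k d)
    analysable-extᾱ⁻¹ d = analysable-elim (λ k → Analysable 𝔣 (extᾱ⁻¹ k d)) λ f∈𝔣 w B _ _ k≈ →
      analysable-≈ (≈-sym (extᾱ⁻¹-factor k≈ d))
        (analysable-post _ _ (analysable-extᾱ⁻¹-κ f∈𝔣 w B d))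

  module _ {H L R} {f : Hom H (L ⊙ R)} (f∈𝔣 : 𝔣 f) where

    α-forces-δʳ : ∀ u → u ≢ [] → ∀ A {S} (h : Hom S (Hᶠ f u A)) →
                  ¬ Analysable 𝔣 (κ f u A ∘ h) →
                  IsComp-α h → u ≡ ‵δʳ ∷ [] × ⊗-Product H
    α-forces-δʳ [] u≢[] _ _ _ _ = ⊥-elim (u≢[] refl)
    α-forces-δʳ (‵ᾱ ∷ _) _ (_ ∷ _) _ _ (_ , _ , _ , h≋) = ⊥-elim (⊗≢⊙ (sym (≋-target h≋)))
    α-forces-δʳ (‵ᾱ⁻¹ ∷ _) _ _ _ _ (_ , _ , _ , h≋) = ⊥-elim (⊗≢⊙ (sym (≋-target h≋)))
    α-forces-δʳ (‵δˡ ∷ u) _ (_ ∷ A) h ¬an (a , b , _ , h≋)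
      with refl , refl ← ⊗-injective (≋-target h≋) =
      ⊥-elim (¬an (analysable-∘-≋ h≋ (extδˡ-α (κ f u A) a b)
        (analysable-post _ _ (analysable-κ f∈𝔣 (‵δˡ ∷ ‵δˡ ∷ u) (a ∷ b ∷ A)))))
    α-forces-δʳ (‵δʳ ∷ []) _ (_ ∷ []) _ _ (a , b , _ , h≋) =
      refl , a , b , proj₁ (⊗-injective (≋-target h≋))
    α-forces-δʳ (‵δʳ ∷ ‵ᾱ ∷ _) _ (_ ∷ _) _ _ (_ , _ , _ , h≋) =
      ⊥-elim (⊗≢⊙ (sym (proj₁ (⊗-injective (≋-target h≋)))))
    α-forces-δʳ (‵δʳ ∷ ‵ᾱ⁻¹ ∷ _) _ _ _ _ (_ , _ , _ , h≋) =
      ⊥-elim (⊗≢⊙ (sym (proj₁ (⊗-injective (≋-target h≋)))))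
    α-forces-δʳ (‵δʳ ∷ ‵δˡ ∷ u) _ (x ∷ A) h ¬an (_ , _ , _ , h≋)
      with q , refl ← ⊗-injective (≋-target h≋)
      with refl , refl ← ⊗-injective q =
      ⊥-elim (¬an (analysable-∘-≋ h≋ (extδʳ-extδˡ-α (κ f u (init A)) x (last A))
        (analysable-κ f∈𝔣 (‵δˡ ∷ ‵δʳ ∷ u) (x ∷ A))))
    α-forces-δʳ (‵δʳ ∷ ‵δʳ ∷ u) _ A h ¬an (_ , b , c , h≋)
      with q , refl ← ⊗-injective (≋-target h≋)
      with refl , refl ← ⊗-injective q =
      ⊥-elim (¬an (analysable-∘-≋ h≋ (extδʳ-extδʳ-α (κ f u (init (init A))) b c)
        (analysable-post _ _ (analysable-extδʳ (b ⊗ c) (analysable-κ f∈𝔣 u (init (init A)))))))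

    α⁻¹-forces-δˡ : ∀ u → u ≢ [] → ∀ A {S} (h : Hom S (Hᶠ f u A)) →
                    ¬ Analysable 𝔣 (κ f u A ∘ h) →
                    IsComp-α⁻¹ h → u ≡ ‵δˡ ∷ [] × ⊗-Product H
    α⁻¹-forces-δˡ [] u≢[] _ _ _ _ = ⊥-elim (u≢[] refl)
    α⁻¹-forces-δˡ (‵ᾱ ∷ _) _ (_ ∷ _) _ _ (_ , _ , _ , h≋) = ⊥-elim (⊗≢⊙ (sym (≋-target h≋)))
    α⁻¹-forces-δˡ (‵ᾱ⁻¹ ∷ _) _ _ _ _ (_ , _ , _ , h≋) = ⊥-elim (⊗≢⊙ (sym (≋-target h≋)))
    α⁻¹-forces-δˡ (‵δʳ ∷ u) _ A h ¬an (_ , b , c , h≋)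
      -- last A is abstracted so that tidiness can identify it with b ⊗ c.
      with _ ← last A
      with refl , refl ← ⊗-injective (≋-target h≋) =
      ⊥-elim (¬an (analysable-∘-≋ h≋ (extδʳ-α⁻¹ (κ f u (init A)) b c)
        (analysable-post _ _ (analysable-extδʳ c
          (analysable-extδʳ b (analysable-κ f∈𝔣 u (init A)))))))
    α⁻¹-forces-δˡ (‵δˡ ∷ []) _ (_ ∷ []) _ _ (_ , b , c , h≋) =
      refl , b , c , proj₂ (⊗-injective (≋-target h≋))
    α⁻¹-forces-δˡ (‵δˡ ∷ ‵ᾱ ∷ _) _ (_ ∷ _ ∷ _) _ _ (_ , _ , _ , h≋) =
      ⊥-elim (⊗≢⊙ (sym (proj₂ (⊗-injective (≋-target h≋)))))
    α⁻¹-forces-δˡ (‵δˡ ∷ ‵ᾱ⁻¹ ∷ _) _ (_ ∷ _) _ _ (_ , _ , _ , h≋) =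
      ⊥-elim (⊗≢⊙ (sym (proj₂ (⊗-injective (≋-target h≋)))))
    α⁻¹-forces-δˡ (‵δˡ ∷ ‵δˡ ∷ u) _ (x ∷ y ∷ A) h ¬an (_ , _ , _ , h≋)
      with refl , q ← ⊗-injective (≋-target h≋)
      with refl , refl ← ⊗-injective q =
      ⊥-elim (¬an (analysable-∘-≋ h≋ (extδˡ-extδˡ-α⁻¹ (κ f u A) x y)
        (analysable-post _ _ (analysable-κ f∈𝔣 (‵δˡ ∷ u) ((x ⊗ y) ∷ A)))))
    α⁻¹-forces-δˡ (‵δˡ ∷ ‵δʳ ∷ u) _ (x ∷ A) h ¬an (_ , _ , _ , h≋)
      with refl , q ← ⊗-injective (≋-target h≋)
      with refl , refl ← ⊗-injective q =
      ⊥-elim (¬an (analysable-∘-≋ h≋ (extδˡ-extδʳ-α⁻¹ (κ f u (init A)) x (last A))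
        (analysable-extδʳ (last A) (analysable-κ f∈𝔣 (‵δˡ ∷ u) (x ∷ init A)))))

    δˡ-forces-ᾱ⁻¹ : ∀ u → u ≢ [] → ∀ A {S} (h : Hom S (Hᶠ f u A)) →
                    ¬ Analysable 𝔣 (κ f u A ∘ h) →
                    IsComp-δˡ h → u ≡ ‵ᾱ⁻¹ ∷ [] × ⊗-Product H
    δˡ-forces-ᾱ⁻¹ [] u≢[] _ _ _ _ = ⊥-elim (u≢[] refl)
    δˡ-forces-ᾱ⁻¹ (‵δˡ ∷ _) _ (_ ∷ _) _ _ (_ , _ , _ , h≋) = ⊥-elim (⊗≢⊙ (≋-target h≋))
    δˡ-forces-ᾱ⁻¹ (‵δʳ ∷ _) _ _ _ _ (_ , _ , _ , h≋) = ⊥-elim (⊗≢⊙ (≋-target h≋))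
    δˡ-forces-ᾱ⁻¹ (‵ᾱ ∷ u) _ (_ ∷ A) h ¬an (a , b , _ , h≋)
      with refl , refl ← ⊙-injective (≋-target h≋) =
      ⊥-elim (¬an (analysable-∘-≋ h≋ (extᾱ-δˡ (κ f u A) a b)
        (analysable-post _ _ (analysable-κ f∈𝔣 (‵δˡ ∷ ‵ᾱ ∷ u) (a ∷ b ∷ A)))))
    δˡ-forces-ᾱ⁻¹ (‵ᾱ⁻¹ ∷ []) _ (_ ∷ []) _ _ (a , b , _ , h≋) =
      refl , a , b , proj₁ (⊙-injective (≋-target h≋))
    δˡ-forces-ᾱ⁻¹ (‵ᾱ⁻¹ ∷ ‵ᾱ ∷ _) _ (_ ∷ _) _ _ (_ , _ , _ , h≋) =
      ⊥-elim (⊗≢⊙ (sym (proj₁ (⊙-injective (≋-target h≋)))))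
    δˡ-forces-ᾱ⁻¹ (‵ᾱ⁻¹ ∷ ‵ᾱ⁻¹ ∷ _) _ _ _ _ (_ , _ , _ , h≋) =
      ⊥-elim (⊗≢⊙ (sym (proj₁ (⊙-injective (≋-target h≋)))))
    δˡ-forces-ᾱ⁻¹ (‵ᾱ⁻¹ ∷ ‵δˡ ∷ u) _ (x ∷ A) h ¬an (_ , _ , _ , h≋)
      with q , refl ← ⊙-injective (≋-target h≋)
      with refl , refl ← ⊗-injective q =
      ⊥-elim (¬an (analysable-∘-≋ h≋ (extᾱ⁻¹-extδˡ-δˡ (κ f u (init A)) x (last A))
        (analysable-κ f∈𝔣 (‵δˡ ∷ ‵ᾱ⁻¹ ∷ u) (x ∷ A))))
    δˡ-forces-ᾱ⁻¹ (‵ᾱ⁻¹ ∷ ‵δʳ ∷ u) _ A h ¬an (_ , b , c , h≋)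
      with q , refl ← ⊙-injective (≋-target h≋)
      with refl , refl ← ⊗-injective q =
      ⊥-elim (¬an (analysable-∘-≋ h≋ (extᾱ⁻¹-extδʳ-δˡ (κ f u (init (init A))) b c)
        (analysable-post _ _ (analysable-extδʳ (b ⊙ c) (analysable-κ f∈𝔣 u (init (init A)))))))

    δʳ-forces-ᾱ : ∀ u → u ≢ [] → ∀ A {S} (h : Hom S (Hᶠ f u A)) →
                  ¬ Analysable 𝔣 (κ f u A ∘ h) →
                  IsComp-δʳ h → u ≡ ‵ᾱ ∷ [] × ⊗-Product H
    δʳ-forces-ᾱ [] u≢[] _ _ _ _ = ⊥-elim (u≢[] refl)
    δʳ-forces-ᾱ (‵δˡ ∷ _) _ (_ ∷ _) _ _ (_ , _ , _ , h≋) = ⊥-elim (⊗≢⊙ (≋-target h≋))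
    δʳ-forces-ᾱ (‵δʳ ∷ _) _ _ _ _ (_ , _ , _ , h≋) = ⊥-elim (⊗≢⊙ (≋-target h≋))
    δʳ-forces-ᾱ (‵ᾱ⁻¹ ∷ u) _ A h ¬an (_ , b , c , h≋)
      with _ ← last A
      with refl , refl ← ⊙-injective (≋-target h≋) =
      ⊥-elim (¬an (analysable-∘-≋ h≋ (extᾱ⁻¹-δʳ (κ f u (init A)) b c)
        (analysable-post _ _ (analysable-extδʳ c
          (analysable-extᾱ⁻¹ b (analysable-κ f∈𝔣 u (init A)))))))
    δʳ-forces-ᾱ (‵ᾱ ∷ []) _ (_ ∷ []) _ _ (_ , b , c , h≋) =
      refl , b , c , proj₂ (⊙-injective (≋-target h≋))
    δʳ-forces-ᾱ (‵ᾱ ∷ ‵ᾱ ∷ _) _ (_ ∷ _ ∷ _) _ _ (_ , _ , _ , h≋) =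
      ⊥-elim (⊗≢⊙ (sym (proj₂ (⊙-injective (≋-target h≋)))))
    δʳ-forces-ᾱ (‵ᾱ ∷ ‵ᾱ⁻¹ ∷ _) _ (_ ∷ _) _ _ (_ , _ , _ , h≋) =
      ⊥-elim (⊗≢⊙ (sym (proj₂ (⊙-injective (≋-target h≋)))))
    δʳ-forces-ᾱ (‵ᾱ ∷ ‵δˡ ∷ u) _ (x ∷ y ∷ A) h ¬an (_ , _ , _ , h≋)
      with refl , q ← ⊙-injective (≋-target h≋)
      with refl , refl ← ⊗-injective q =
      ⊥-elim (¬an (analysable-∘-≋ h≋ (extᾱ-extδˡ-δʳ (κ f u A) x y)
        (analysable-post _ _ (analysable-κ f∈𝔣 (‵δˡ ∷ u) ((x ⊙ y) ∷ A)))))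
    δʳ-forces-ᾱ (‵ᾱ ∷ ‵δʳ ∷ u) _ (x ∷ A) h ¬an (_ , _ , _ , h≋)
      with refl , q ← ⊙-injective (≋-target h≋)
      with refl , refl ← ⊗-injective q =
      ⊥-elim (¬an (analysable-∘-≋ h≋ (extᾱ-extδʳ-δʳ (κ f u (init A)) x (last A))
        (analysable-extδʳ (last A) (analysable-κ f∈𝔣 (‵ᾱ ∷ u) (x ∷ init A)))))

    ᾱ-forces-ᾱ⁻¹ : ∀ u → u ≢ [] → ∀ A {S} (h : Hom S (Hᶠ f u A)) →
                   ¬ Analysable 𝔣 (κ f u A ∘ h) →
                   IsComp-ᾱ h → u ≡ ‵ᾱ⁻¹ ∷ [] × ⊙-Product H
    ᾱ-forces-ᾱ⁻¹ [] u≢[] _ _ _ _ = ⊥-elim (u≢[] refl)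
    ᾱ-forces-ᾱ⁻¹ (‵δˡ ∷ _) _ (_ ∷ _) _ _ (_ , _ , _ , h≋) = ⊥-elim (⊗≢⊙ (≋-target h≋))
    ᾱ-forces-ᾱ⁻¹ (‵δʳ ∷ _) _ _ _ _ (_ , _ , _ , h≋) = ⊥-elim (⊗≢⊙ (≋-target h≋))
    ᾱ-forces-ᾱ⁻¹ (‵ᾱ ∷ u) _ (_ ∷ A) h ¬an (a , b , _ , h≋)
      with refl , refl ← ⊙-injective (≋-target h≋) =
      ⊥-elim (¬an (analysable-∘-≋ h≋ (extᾱ-ᾱ (κ f u A) a b)
        (analysable-post _ _ (analysable-κ f∈𝔣 (‵ᾱ ∷ ‵ᾱ ∷ u) (a ∷ b ∷ A)))))
    ᾱ-forces-ᾱ⁻¹ (‵ᾱ⁻¹ ∷ []) _ (_ ∷ []) _ _ (a , b , _ , h≋) =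
      refl , a , b , proj₁ (⊙-injective (≋-target h≋))
    ᾱ-forces-ᾱ⁻¹ (‵ᾱ⁻¹ ∷ ‵δˡ ∷ _) _ (_ ∷ _) _ _ (_ , _ , _ , h≋) =
      ⊥-elim (⊗≢⊙ (proj₁ (⊙-injective (≋-target h≋))))
    ᾱ-forces-ᾱ⁻¹ (‵ᾱ⁻¹ ∷ ‵δʳ ∷ _) _ _ _ _ (_ , _ , _ , h≋) =
      ⊥-elim (⊗≢⊙ (proj₁ (⊙-injective (≋-target h≋))))
    ᾱ-forces-ᾱ⁻¹ (‵ᾱ⁻¹ ∷ ‵ᾱ ∷ u) _ (x ∷ A) h ¬an (_ , _ , _ , h≋)
      with q , refl ← ⊙-injective (≋-target h≋)
      with refl , refl ← ⊙-injective q =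
      ⊥-elim (¬an (analysable-∘-≋ h≋ (extᾱ⁻¹-extᾱ-ᾱ (κ f u (init A)) x (last A))
        (analysable-κ f∈𝔣 (‵ᾱ ∷ ‵ᾱ⁻¹ ∷ u) (x ∷ A))))
    ᾱ-forces-ᾱ⁻¹ (‵ᾱ⁻¹ ∷ ‵ᾱ⁻¹ ∷ u) _ A h ¬an (_ , b , c , h≋)
      with q , refl ← ⊙-injective (≋-target h≋)
      with refl , refl ← ⊙-injective q =
      ⊥-elim (¬an (analysable-∘-≋ h≋ (extᾱ⁻¹-extᾱ⁻¹-ᾱ (κ f u (init (init A))) b c)
        (analysable-post _ _ (analysable-extᾱ⁻¹ (b ⊙ c) (analysable-κ f∈𝔣 u (init (init A)))))))

    ᾱ⁻¹-forces-ᾱ : ∀ u → u ≢ [] → ∀ A {S} (h : Hom S (Hᶠ f u A)) →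
                   ¬ Analysable 𝔣 (κ f u A ∘ h) →
                   IsComp-ᾱ⁻¹ h → u ≡ ‵ᾱ ∷ [] × ⊙-Product H
    ᾱ⁻¹-forces-ᾱ [] u≢[] _ _ _ _ = ⊥-elim (u≢[] refl)
    ᾱ⁻¹-forces-ᾱ (‵δˡ ∷ _) _ (_ ∷ _) _ _ (_ , _ , _ , h≋) = ⊥-elim (⊗≢⊙ (≋-target h≋))
    ᾱ⁻¹-forces-ᾱ (‵δʳ ∷ _) _ _ _ _ (_ , _ , _ , h≋) = ⊥-elim (⊗≢⊙ (≋-target h≋))
    ᾱ⁻¹-forces-ᾱ (‵ᾱ⁻¹ ∷ u) _ A h ¬an (_ , b , c , h≋)
      with _ ← last A
      with refl , refl ← ⊙-injective (≋-target h≋) =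
      ⊥-elim (¬an (analysable-∘-≋ h≋ (extᾱ⁻¹-ᾱ⁻¹ (κ f u (init A)) b c)
        (analysable-post _ _ (analysable-extᾱ⁻¹ c
          (analysable-extᾱ⁻¹ b (analysable-κ f∈𝔣 u (init A)))))))
    ᾱ⁻¹-forces-ᾱ (‵ᾱ ∷ []) _ (_ ∷ []) _ _ (_ , b , c , h≋) =
      refl , b , c , proj₂ (⊙-injective (≋-target h≋))
    ᾱ⁻¹-forces-ᾱ (‵ᾱ ∷ ‵δˡ ∷ _) _ (_ ∷ _ ∷ _) _ _ (_ , _ , _ , h≋) =
      ⊥-elim (⊗≢⊙ (proj₂ (⊙-injective (≋-target h≋))))
    ᾱ⁻¹-forces-ᾱ (‵ᾱ ∷ ‵δʳ ∷ _) _ (_ ∷ _) _ _ (_ , _ , _ , h≋) =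
      ⊥-elim (⊗≢⊙ (proj₂ (⊙-injective (≋-target h≋))))
    ᾱ⁻¹-forces-ᾱ (‵ᾱ ∷ ‵ᾱ ∷ u) _ (x ∷ y ∷ A) h ¬an (_ , _ , _ , h≋)
      with refl , q ← ⊙-injective (≋-target h≋)
      with refl , refl ← ⊙-injective q =
      ⊥-elim (¬an (analysable-∘-≋ h≋ (extᾱ-extᾱ-ᾱ⁻¹ (κ f u A) x y)
        (analysable-post _ _ (analysable-κ f∈𝔣 (‵ᾱ ∷ u) ((x ⊙ y) ∷ A)))))
    ᾱ⁻¹-forces-ᾱ (‵ᾱ ∷ ‵ᾱ⁻¹ ∷ u) _ (x ∷ A) h ¬an (_ , _ , _ , h≋)
      with refl , q ← ⊙-injective (≋-target h≋)
      with refl , refl ← ⊙-injective q =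
      ⊥-elim (¬an (analysable-∘-≋ h≋ (extᾱ-extᾱ⁻¹-ᾱ⁻¹ (κ f u (init A)) x (last A))
        (analysable-extᾱ⁻¹ (last A) (analysable-κ f∈𝔣 (‵ᾱ ∷ u) (x ∷ init A)))))

    PeelsOff : Letter → (∀ {n} → Vec Obj (suc n) → Vec Obj n) → ∀ u → Vec Obj (length u) →
               ∀ {X Y} → Hom X Y → Set (o ⊔ ℓ ⊔ e ⊔ p)
    PeelsOff m rest u A {X} {Y} h' =
      Σ Word λ v → Σ (u ≡ m ∷ v) λ eq →
      let A' = subst (λ w → Vec Obj (length w)) eq A in
      Σ (Y ≡ Hᶠ f v (rest A')) λ q →
      ¬ Analysable 𝔣 (κ f v (rest A') ∘ subst (Hom X) q h')

    id⊗-forces-δˡ : ∀ u → u ≢ [] → ∀ A {S} (h : Hom S (Hᶠ f u A)) →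
                    ¬ Analysable 𝔣 (κ f u A ∘ h) →
                    ∀ {X Y} B (h' : Hom X Y) → h ≋ id B ⊗₁ h' → PeelsOff ‵δˡ tail u A h'
    id⊗-forces-δˡ [] u≢[] _ _ _ _ _ _ = ⊥-elim (u≢[] refl)
    id⊗-forces-δˡ (‵ᾱ ∷ _) _ (_ ∷ _) _ _ _ _ h≋ = ⊥-elim (⊗≢⊙ (sym (≋-target h≋)))
    id⊗-forces-δˡ (‵ᾱ⁻¹ ∷ _) _ _ _ _ _ _ h≋ = ⊥-elim (⊗≢⊙ (sym (≋-target h≋)))
    id⊗-forces-δˡ (‵δˡ ∷ v) _ (x ∷ A) h ¬an _ h' h≋
      with refl , refl ← ⊗-injective (≋-target h≋) =
      v , refl , refl , λ an →
        ¬an (analysable-∘-≋ h≋ (extδˡ-∘ (κ f v A) x h') (analysable-extδˡ x an))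
    id⊗-forces-δˡ (‵δʳ ∷ v) _ A h ¬an _ h' h≋
      with refl , refl ← ⊗-injective (≋-target h≋) =
      ⊥-elim (¬an (analysable-∘-≋ h≋ (extδʳ-id⊗ (κ f v (init A)) h')
        (analysable-post _ _ (analysable-extδʳ _ (analysable-κ f∈𝔣 v (init A))))))

    ⊗id-forces-δʳ : ∀ u → u ≢ [] → ∀ A {S} (h : Hom S (Hᶠ f u A)) →
                    ¬ Analysable 𝔣 (κ f u A ∘ h) →
                    ∀ {X Y} B (h' : Hom X Y) → h ≋ h' ⊗₁ id B → PeelsOff ‵δʳ init u A h'
    ⊗id-forces-δʳ [] u≢[] _ _ _ _ _ _ = ⊥-elim (u≢[] refl)
    ⊗id-forces-δʳ (‵ᾱ ∷ _) _ (_ ∷ _) _ _ _ _ h≋ = ⊥-elim (⊗≢⊙ (sym (≋-target h≋)))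
    ⊗id-forces-δʳ (‵ᾱ⁻¹ ∷ _) _ _ _ _ _ _ h≋ = ⊥-elim (⊗≢⊙ (sym (≋-target h≋)))
    ⊗id-forces-δʳ (‵δʳ ∷ v) _ A h ¬an _ h' h≋
      with refl , refl ← ⊗-injective (≋-target h≋) =
      v , refl , refl , λ an →
        ¬an (analysable-∘-≋ h≋ (extδʳ-∘ (κ f v (init A)) (last A) h')
          (analysable-extδʳ (last A) an))
    ⊗id-forces-δʳ (‵δˡ ∷ v) _ (_ ∷ A) h ¬an _ h' h≋
      with refl , refl ← ⊗-injective (≋-target h≋) =
      ⊥-elim (¬an (analysable-∘-≋ h≋ (extδˡ-⊗id (κ f v A) h')
        (analysable-post _ _ (analysable-κ f∈𝔣 (‵δˡ ∷ v) (_ ∷ A)))))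

    id⊙-forces-ᾱ : ∀ u → u ≢ [] → ∀ A {S} (h : Hom S (Hᶠ f u A)) →
                   ¬ Analysable 𝔣 (κ f u A ∘ h) →
                   ∀ {X Y} B (h' : Hom X Y) → h ≋ id B ⊙₁ h' → PeelsOff ‵ᾱ tail u A h'
    id⊙-forces-ᾱ [] u≢[] _ _ _ _ _ _ = ⊥-elim (u≢[] refl)
    id⊙-forces-ᾱ (‵δˡ ∷ _) _ (_ ∷ _) _ _ _ _ h≋ = ⊥-elim (⊗≢⊙ (≋-target h≋))
    id⊙-forces-ᾱ (‵δʳ ∷ _) _ _ _ _ _ _ h≋ = ⊥-elim (⊗≢⊙ (≋-target h≋))
    id⊙-forces-ᾱ (‵ᾱ ∷ v) _ (x ∷ A) h ¬an _ h' h≋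
      with refl , refl ← ⊙-injective (≋-target h≋) =
      v , refl , refl , λ an →
        ¬an (analysable-∘-≋ h≋ (extᾱ-∘ (κ f v A) x h') (analysable-extᾱ x an))
    id⊙-forces-ᾱ (‵ᾱ⁻¹ ∷ v) _ A h ¬an _ h' h≋
      with refl , refl ← ⊙-injective (≋-target h≋) =
      ⊥-elim (¬an (analysable-∘-≋ h≋ (extᾱ⁻¹-id⊙ (κ f v (init A)) h')
        (analysable-post _ _ (analysable-extᾱ⁻¹ _ (analysable-κ f∈𝔣 v (init A))))))

    ⊙id-forces-ᾱ⁻¹ : ∀ u → u ≢ [] → ∀ A {S} (h : Hom S (Hᶠ f u A)) →
                     ¬ Analysable 𝔣 (κ f u A ∘ h) →
                     ∀ {X Y} B (h' : Hom X Y) → h ≋ h' ⊙₁ id B → PeelsOff ‵ᾱ⁻¹ init u A h'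
    ⊙id-forces-ᾱ⁻¹ [] u≢[] _ _ _ _ _ _ = ⊥-elim (u≢[] refl)
    ⊙id-forces-ᾱ⁻¹ (‵δˡ ∷ _) _ (_ ∷ _) _ _ _ _ h≋ = ⊥-elim (⊗≢⊙ (≋-target h≋))
    ⊙id-forces-ᾱ⁻¹ (‵δʳ ∷ _) _ _ _ _ _ _ h≋ = ⊥-elim (⊗≢⊙ (≋-target h≋))
    ⊙id-forces-ᾱ⁻¹ (‵ᾱ⁻¹ ∷ v) _ A h ¬an _ h' h≋
      with refl , refl ← ⊙-injective (≋-target h≋) =
      v , refl , refl , λ an →
        ¬an (analysable-∘-≋ h≋ (extᾱ⁻¹-∘ (κ f v (init A)) (last A) h')
          (analysable-extᾱ⁻¹ (last A) an))
    ⊙id-forces-ᾱ⁻¹ (‵ᾱ ∷ v) _ (_ ∷ A) h ¬an _ h' h≋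
      with refl , refl ← ⊙-injective (≋-target h≋) =
      ⊥-elim (¬an (analysable-∘-≋ h≋ (extᾱ-⊙id (κ f v A) h')
        (analysable-post _ _ (analysable-κ f∈𝔣 (‵ᾱ ∷ v) (_ ∷ A)))))

lemma3p18 :
    ∀ {o ℓ e p : Level} (𝒞 : LDCategory o ℓ e) →
    let open LDDefs 𝒞 in
    Tidy →
    (𝔣 : MorphismSet p) →
    (∀ {X Y} (g : Hom X Y) → 𝔣 g → ⊙-Product Y) →
    (u : Word) → u ≢ [] →
    ∀ {H L R} (f : Hom H (L ⊙ R)) → 𝔣 f →
    (A : Vec Obj (length u)) →
    ∀ {S} (h : Hom S (Hᶠ f u A)) →
    ¬ Analysable 𝔣 (κ f u A ∘ h) →
    -- (i)
    ((IsComp-α h → u ≡ ‵δʳ ∷ [] × ⊗-Product H)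
     × (IsComp-α⁻¹ h → u ≡ ‵δˡ ∷ [] × ⊗-Product H)
     × (IsComp-δˡ h → u ≡ ‵ᾱ⁻¹ ∷ [] × ⊗-Product H)
     × (IsComp-δʳ h → u ≡ ‵ᾱ ∷ [] × ⊗-Product H)
     × (IsComp-ᾱ h → u ≡ ‵ᾱ⁻¹ ∷ [] × ⊙-Product H)
     × (IsComp-ᾱ⁻¹ h → u ≡ ‵ᾱ ∷ [] × ⊙-Product H))
    ×
    -- (ii)
    ((∀ {X Y} B (h' : Hom X Y) → h ≋ id B ⊗₁ h' →
       Σ Word λ v → Σ (u ≡ ‵δˡ ∷ v) λ eq →
       let A' = subst (λ w → Vec Obj (length w)) eq A in
       Σ (Y ≡ Hᶠ f v (tail A')) λ q →
       ¬ Analysable 𝔣 (κ f v (tail A') ∘ subst (Hom X) q h'))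
     × (∀ {X Y} B (h' : Hom X Y) → h ≋ h' ⊗₁ id B →
       Σ Word λ v → Σ (u ≡ ‵δʳ ∷ v) λ eq →
       let A' = subst (λ w → Vec Obj (length w)) eq A in
       Σ (Y ≡ Hᶠ f v (init A')) λ q →
       ¬ Analysable 𝔣 (κ f v (init A') ∘ subst (Hom X) q h'))
     × (∀ {X Y} B (h' : Hom X Y) → h ≋ id B ⊙₁ h' →
       Σ Word λ v → Σ (u ≡ ‵ᾱ ∷ v) λ eq →
       let A' = subst (λ w → Vec Obj (length w)) eq A in
       Σ (Y ≡ Hᶠ f v (tail A')) λ q →
       ¬ Analysable 𝔣 (κ f v (tail A') ∘ subst (Hom X) q h'))
     × (∀ {X Y} B (h' : Hom X Y) → h ≋ h' ⊙₁ id B →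
       Σ Word λ v → Σ (u ≡ ‵ᾱ⁻¹ ∷ v) λ eq →
       let A' = subst (λ w → Vec Obj (length w)) eq A in
       Σ (Y ≡ Hᶠ f v (init A')) λ q →
       ¬ Analysable 𝔣 (κ f v (init A') ∘ subst (Hom X) q h')))
lemma3p18 𝒞 tidy 𝔣 _ u u≢[] f f∈𝔣 A h ¬an =
    ( α-forces-δʳ f∈𝔣 u u≢[] A h ¬an
    , α⁻¹-forces-δˡ f∈𝔣 u u≢[] A h ¬an
    , δˡ-forces-ᾱ⁻¹ f∈𝔣 u u≢[] A h ¬an
    , δʳ-forces-ᾱ f∈𝔣 u u≢[] A h ¬an
    , ᾱ-forces-ᾱ⁻¹ f∈𝔣 u u≢[] A h ¬an
    , ᾱ⁻¹-forces-ᾱ f∈𝔣 u u≢[] A h ¬an )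
  , ( id⊗-forces-δˡ f∈𝔣 u u≢[] A h ¬an
    , ⊗id-forces-δʳ f∈𝔣 u u≢[] A h ¬an
    , id⊙-forces-ᾱ f∈𝔣 u u≢[] A h ¬an
    , ⊙id-forces-ᾱ⁻¹ f∈𝔣 u u≢[] A h ¬an )
  where open Analysability 𝒞 tidy 𝔣
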